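{- Let $n=p_1^{\alpha_1}p_2^{\alpha_2}p_3^{\alpha_3}$, where $\alpha_1,\alpha_2,\alpha_3$ are positive integers and $p_1<p_2<p_3$ are prime numbers. Let $i,j\in\{1,2,3\}$ with $i<j$. If $1\leq\beta_i\leq\alpha_i$ and $2\leq\beta_j\leq\alpha_j$, then $\deg(p_i^{\beta_i}p_j^{\beta_j})>\deg(p_i^{\beta_i-1}p_j^{\beta_j})$ in $\mathcal{P}(C_n)$.
   Context: For a finite group $G$, the power graph $\mathcal{P}(G)$ is the simple undirected graph with vertex set $G$ in which two distinct vertices are adjacent if one of them is an integral power of the other. $C_n$ denotes the cyclic group of order $n$, identified with $\mathbb{Z}_n=\{0,1,\ldots,n-1\}$; a positive divisor $d$ of $n$ is regarded as the vertex $d \bmod n$. $\deg(a)$ denotes the degree of vertex $a$ in $\mathcal{P}(C_n)$. -}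

module Defs where

open import Data.Nat using (ℕ; zero; suc; _*_)
open import Data.Nat.DivMod using (_%_)
open import Data.Nat.Properties using (_≟_)
open import Data.List using (List; upTo; filter; length)
open import Data.List.Relation.Unary.Any using (Any; any?)
open import Data.Product using (_×_)
open import Data.Sum using (_⊎_)
open import Relation.Nullary using (¬_; Dec)
open import Relation.Nullary.Decidable using (_×-dec_; _⊎-dec_; ¬?)
open import Relation.Binary.PropositionalEquality using (_≡_)

-- reduction modulo n (the group Z_n = {0,...,n-1}); n = 0 never occurs in use
_mod_ : ℕ → ℕ → ℕ
a mod zero    = a
a mod (suc m) = a % suc m

-- b is an integral power of a in C_n ≅ (Z_n,+): b = k·a (mod n) for some
-- integer k; since k·a only depends on k mod n, k ranges over 0,...,n-1.
IsPower : ℕ → ℕ → ℕ → Set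
IsPower n a b = Any (λ k → (k * a) mod n ≡ b) (upTo n)

isPower? : ∀ n a b → Dec (IsPower n a b)
isPower? n a b = any? (λ k → ((k * a) mod n) ≟ b) (upTo n)

Adj : ℕ → ℕ → ℕ → Set
Adj n a b = ¬ (a ≡ b) × (IsPower n a b ⊎ IsPower n b a)

adj? : ∀ n a b → Dec (Adj n a b)
adj? n a b = ¬? (a ≟ b) ×-dec (isPower? n a b ⊎-dec isPower? n b a)

deg : ℕ → ℕ → ℕ
deg n a = length (filter (adj? n (a mod n)) (upTo n))

module Submission where

-- Let n = q^A·r^B·s^C for distinct primes with q < r, let a = q^β·r^γ (β ≥ 1, γ ≥ 2)
-- and b = q^(β−1)·r^γ, so that a = q·b in Z_n.  We compare the neighbourhoods of a
-- and b in the power graph P(C_n), where x ~ y iff one is a multiple of the other mod n.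
-- • A neighbour of b that is not one of a is a itself or a multiple of b·s, or of b·r
--   when b·r divides n (b-only-neighbour); there are at most n/bs + n/br of these.
-- • A "primitive" multiple w·d of d = q^β (w coprime to n/d) is a neighbour of a but
--   not of b (primitive-a-only); a generalised totient count (count-primitive) shows
--   there are φ(n/d) = ∏ p^(k−1)(p − 1) of them.
-- • A polynomial inequality in q, r, s (key-inequality) gives φ(n/d) ≥ n/bs + n/br + 2,
--   and a general counting comparison (count-compare) then yields deg a > deg b.

open import Defs
open import Data.Nat using (ℕ; _*_; _^_; _≤_; _<_; _>_; _∸_)
open import Data.Nat.Primality using (Prime)
open import Data.Fin using (Fin; zero; suc)
open import Data.Fin renaming (_<_ to _<ᶠ_) using ()
open import Relation.Binary.PropositionalEquality using (_≡_)

open import Data.Nat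
open import Data.Nat.Properties
open import Data.Nat.DivMod hiding (_mod_)
open import Data.Nat.Divisibility
open import Data.Nat.Coprimality using (Coprime; coprime-Bézout; coprime-divisor)
open import Data.Nat.GCD using (module Bézout)
open import Data.Nat.Primality using (prime⇒irreducible; prime⇒nonZero; prime⇒nonTrivial; euclidsLemma)
open import Data.Nat.ListAction using (product)
open import Data.Nat.Tactic.RingSolver using (solve-∀)
open import Algebra.Properties.CommutativeSemigroup +-commutativeSemigroup using (interchange)
open import Data.Bool using (if_then_else_)
open import Data.List using (List; []; _∷_; map; upTo; filter; length; [_]; _++_)
open import Data.List.Properties using (upTo-∷ʳ; length-++; filter-++)
open import Data.List.Relation.Unary.Any as Any using (satisfied)
open import Data.List.Relation.Unary.All as All using (All; []; _∷_; all?)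
open import Data.List.Relation.Unary.AllPairs using (AllPairs; []; _∷_)
open import Data.List.Membership.Propositional.Properties using (∈-upTo⁺)
open import Data.Product using (_×_; _,_; proj₁; proj₂; ∃)
open import Data.Sum using (_⊎_; inj₁; inj₂; [_,_]′)
open import Data.Empty using (⊥-elim)
open import Function using (_∘_)
open import Level using (0ℓ)
open import Relation.Nullary using (¬_; Dec; yes; no; does)
open import Relation.Nullary.Decidable using (_×-dec_; _⊎-dec_; ¬?)
open import Relation.Unary using (Pred; Decidable)
open import Relation.Binary.PropositionalEquality hiding ([_])

indicator : {A : Set} → Dec A → ℕ
indicator d = if does d then 1 else 0

indicator-yes : {A : Set} (d : Dec A) → A → indicator d ≡ 1
indicator-yes (yes _) _ = refl
indicator-yes (no ¬a) a = ⊥-elim (¬a a)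

indicator-no : {A : Set} (d : Dec A) → ¬ A → indicator d ≡ 0
indicator-no (yes a) ¬a = ⊥-elim (¬a a)
indicator-no (no _)  _  = refl

count : {P : Pred ℕ 0ℓ} → Decidable P → ℕ → ℕ
count P? zero    = 0
count P? (suc n) = count P? n + indicator (P? n)

count-filter : {P : Pred ℕ 0ℓ} (P? : Decidable P) (n : ℕ) →
               length (filter P? (upTo n)) ≡ count P? n
count-filter P? zero    = refl
count-filter P? (suc n) = begin
  length (filter P? (upTo (suc n)))               ≡⟨ cong (length ∘ filter P?) (sym (upTo-∷ʳ n)) ⟩
  length (filter P? (upTo n ++ [ n ]))            ≡⟨ cong length (filter-++ P? (upTo n) [ n ]) ⟩
  length (filter P? (upTo n) ++ filter P? [ n ])  ≡⟨ length-++ (filter P? (upTo n)) ⟩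
  length (filter P? (upTo n)) + length (filter P? [ n ])
                                                  ≡⟨ cong₂ _+_ (count-filter P? n) last ⟩
  count P? (suc n)                                ∎
  where
  open ≡-Reasoning
  last : length (filter P? [ n ]) ≡ indicator (P? n)
  last with P? n
  ... | yes _ = refl
  ... | no  _ = refl

count-mono : {P Q : Pred ℕ 0ℓ} (P? : Decidable P) (Q? : Decidable Q) (n : ℕ) →
             (∀ x → x < n → P x → Q x) → count P? n ≤ count Q? n
count-mono P? Q? zero    _   = z≤n
count-mono P? Q? (suc n) P⊆Q =
  +-mono-≤ (count-mono P? Q? n (λ x → P⊆Q x ∘ m<n⇒m<1+n)) (step (P? n) (Q? n))
  where
  step : (p : Dec _) (q : Dec _) → indicator p ≤ indicator q
  step (yes _)  (yes _)  = ≤-refl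
  step (yes Pn) (no ¬Qn) = ⊥-elim (¬Qn (P⊆Q n ≤-refl Pn))
  step (no _)   _        = z≤n

count-cong : {P Q : Pred ℕ 0ℓ} (P? : Decidable P) (Q? : Decidable Q) (n : ℕ) →
             (∀ x → x < n → P x → Q x) → (∀ x → x < n → Q x → P x) →
             count P? n ≡ count Q? n
count-cong P? Q? n P⊆Q Q⊆P = ≤-antisym (count-mono P? Q? n P⊆Q) (count-mono Q? P? n Q⊆P)

count-none : {P : Pred ℕ 0ℓ} (P? : Decidable P) (n : ℕ) → (∀ x → ¬ P x) → count P? n ≡ 0
count-none P? zero    ¬P = refl
count-none P? (suc n) ¬P with P? n
... | yes Pn = ⊥-elim (¬P n Pn)
... | no  _  = trans (+-identityʳ _) (count-none P? n ¬P)

count-split : {P Q : Pred ℕ 0ℓ} (P? : Decidable P) (Q? : Decidable Q) (n : ℕ) →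
              count P? n ≡ count (λ x → P? x ×-dec Q? x) n + count (λ x → P? x ×-dec ¬? (Q? x)) n
count-split P? Q? zero    = refl
count-split P? Q? (suc n) =
  trans (cong₂ _+_ (count-split P? Q? n) (step (P? n) (Q? n)))
        (interchange (count P∧Q? n) (count P∧¬Q? n) (indicator (P∧Q? n)) (indicator (P∧¬Q? n)))
  where
  P∧Q? P∧¬Q? : Decidable _
  P∧Q?  x = P? x ×-dec Q? x
  P∧¬Q? x = P? x ×-dec ¬? (Q? x)
  step : (p : Dec _) (q : Dec _) → indicator p ≡ indicator (p ×-dec q) + indicator (p ×-dec ¬? q)
  step (yes _) (yes _) = refl
  step (yes _) (no _)  = refl
  step (no _)  _       = refl

count-union : {P Q : Pred ℕ 0ℓ} (P? : Decidable P) (Q? : Decidable Q) (n : ℕ) →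
              count (λ x → P? x ⊎-dec Q? x) n ≤ count P? n + count Q? n
count-union P? Q? zero    = z≤n
count-union P? Q? (suc n) =
  ≤-trans (+-mono-≤ (count-union P? Q? n) (step (P? n) (Q? n)))
          (≤-reflexive (interchange (count P? n) (count Q? n) (indicator (P? n)) (indicator (Q? n))))
  where
  step : (p : Dec _) (q : Dec _) → indicator (p ⊎-dec q) ≤ indicator p + indicator q
  step (yes _) _       = s≤s z≤n
  step (no _)  (yes _) = ≤-refl
  step (no _)  (no _)  = z≤n

count-point : (a n : ℕ) → count (_≟ a) n ≡ indicator (a <? n)
count-point a zero    = refl
count-point a (suc n) with a <? n | n ≟ a
... | yes a<n | yes refl = ⊥-elim (<-irrefl refl a<n)
... | yes a<n | no  n≢a  = begin
  count (_≟ a) n + indicator (n ≟ a)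
    ≡⟨ cong₂ _+_ (trans (count-point a n) (indicator-yes (a <? n) a<n)) (indicator-no (n ≟ a) n≢a) ⟩
  1 + 0                  ≡⟨ sym (indicator-yes (a <? suc n) (m<n⇒m<1+n a<n)) ⟩
  indicator (a <? suc n) ∎
  where open ≡-Reasoning
... | no  a≮a  | yes refl = begin
  count (_≟ a) a + indicator (a ≟ a)
    ≡⟨ cong₂ _+_ (trans (count-point a a) (indicator-no (a <? a) a≮a)) (indicator-yes (a ≟ a) refl) ⟩
  0 + 1                  ≡⟨ sym (indicator-yes (a <? suc a) ≤-refl) ⟩
  indicator (a <? suc a) ∎
  where open ≡-Reasoning
... | no  a≮n | no  n≢a  = begin
  count (_≟ a) n + indicator (n ≟ a)
    ≡⟨ cong₂ _+_ (trans (count-point a n) (indicator-no (a <? n) a≮n)) (indicator-no (n ≟ a) n≢a) ⟩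
  0 + 0                  ≡⟨ sym (indicator-no (a <? suc n) a≮1+n) ⟩
  indicator (a <? suc n) ∎
  where
  open ≡-Reasoning
  a≮1+n : ¬ a < suc n
  a≮1+n a<1+n = [ a≮n , n≢a ∘ sym ]′ (m<1+n⇒m<n∨m≡n a<1+n)

count-point≤1 : (a n : ℕ) → count (_≟ a) n ≤ 1
count-point≤1 a n = ≤-trans (≤-reflexive (count-point a n)) (indicator≤1 (a <? n))
  where
  indicator≤1 : {A : Set} (d : Dec A) → indicator d ≤ 1
  indicator≤1 (yes _) = ≤-refl
  indicator≤1 (no _)  = z≤n

count-+ : {P : Pred ℕ 0ℓ} (P? : Decidable P) (a b : ℕ) →
          count P? (a + b) ≡ count P? a + count (λ x → P? (a + x)) b
count-+ P? a zero    = trans (cong (count P?) (+-identityʳ a)) (sym (+-identityʳ _))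
count-+ P? a (suc b) = begin
  count P? (a + suc b)                                              ≡⟨ cong (count P?) (+-suc a b) ⟩
  count P? (a + b) + indicator (P? (a + b))                         ≡⟨ cong (_+ _) (count-+ P? a b) ⟩
  count P? a + count (λ x → P? (a + x)) b + indicator (P? (a + b))  ≡⟨ +-assoc (count P? a) _ _ ⟩
  count P? a + count (λ x → P? (a + x)) (suc b)                     ∎
  where open ≡-Reasoning

-- Below k·m there are exactly k multiples of m (one in each window [i·m, (i+1)·m)).
count-multiples : (m : ℕ) .{{_ : NonZero m}} (k : ℕ) → count (m ∣?_) (k * m) ≡ k
count-multiples m zero    = refl
count-multiples m (suc k) = begin
  count (m ∣?_) (m + k * m)                                    ≡⟨ cong (count (m ∣?_)) (+-comm m (k * m)) ⟩
  count (m ∣?_) (k * m + m)                                    ≡⟨ count-+ (m ∣?_) (k * m) m ⟩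
  count (m ∣?_) (k * m) + count (λ x → m ∣? (k * m + x)) m     ≡⟨ cong₂ _+_ (count-multiples m k) window ⟩
  k + 1                                                        ≡⟨ +-comm k 1 ⟩
  suc k                                                        ∎
  where
  open ≡-Reasoning
  only-start : ∀ x → x < m → m ∣ k * m + x → x ≡ 0
  only-start x x<m m∣ with x ≟ 0
  ... | yes x≡0 = x≡0
  ... | no  x≢0 = ⊥-elim (<⇒≱ x<m (∣⇒≤ {{≢-nonZero x≢0}} (∣m+n∣m⇒∣n m∣ (n∣m*n k))))
  start : ∀ x → x < m → x ≡ 0 → m ∣ k * m + x
  start x _ refl = subst (m ∣_) (sym (+-identityʳ (k * m))) (n∣m*n k)
  window : count (λ x → m ∣? (k * m + x)) m ≡ 1
  window = begin
    count (λ x → m ∣? (k * m + x)) m ≡⟨ count-cong _ (_≟ 0) m only-start start ⟩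
    count (_≟ 0) m                   ≡⟨ count-point 0 m ⟩
    indicator (0 <? m)               ≡⟨ indicator-yes (0 <? m) (>-nonZero⁻¹ m) ⟩
    1                                ∎

-- If m divides n then m·#{y < n | m ∣ y} = n; the guard m ∣ n makes the bound
-- m·#{y < n | m ∣ y and m ∣ n} ≤ n hold unconditionally.
count-multiples-bound : (m n : ℕ) .{{_ : NonZero m}} →
                        m * count (λ y → m ∣? y ×-dec m ∣? n) n ≤ n
count-multiples-bound m n = bound (m ∣? n)
  where
  open ≡-Reasoning
  #guarded : ℕ
  #guarded = count (λ y → m ∣? y ×-dec m ∣? n) n
  bound : Dec (m ∣ n) → m * #guarded ≤ n
  bound (no m∤n) = ≤-trans (≤-reflexive (trans (cong (m *_) none) (*-zeroʳ m))) z≤n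
    where
    none : #guarded ≡ 0
    none = count-none _ n (λ _ → m∤n ∘ proj₂)
  bound (yes m∣n@(divides k n≡km)) = ≤-reflexive (begin
    m * #guarded              ≡⟨ cong (m *_) (count-cong _ (m ∣?_) n (λ _ _ → proj₁) (λ _ _ m∣y → m∣y , m∣n)) ⟩
    m * count (m ∣?_) n       ≡⟨ cong (λ x → m * count (m ∣?_) x) n≡km ⟩
    m * count (m ∣?_) (k * m) ≡⟨ cong (m *_) (count-multiples m k) ⟩
    m * k                     ≡⟨ *-comm m k ⟩
    k * m                     ≡⟨ sym n≡km ⟩
    n                         ∎)

count-compare : {A B T U : Pred ℕ 0ℓ}
                (A? : Decidable A) (B? : Decidable B) (T? : Decidable T) (U? : Decidable U) (a n : ℕ) →
                (∀ y → y < n → B y → ¬ A y → T y ⊎ y ≡ a) →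
                (∀ y → y < n → U y → A y × ¬ B y) →
                count T? n + 2 ≤ count U? n →
                count B? n < count A? n
count-compare A? B? T? U? a n B∖A⊆T+a U⊆A∖B T+2≤U = begin-strict
  count B? n                        ≡⟨ count-split B? A? n ⟩
  count B∧A? n + count B∧¬A? n      ≡⟨ cong (_+ count B∧¬A? n) (count-cong B∧A? A∧B? n swap swap) ⟩
  #A∧B + count B∧¬A? n              ≤⟨ +-monoʳ-≤ #A∧B B∖A-bound ⟩
  #A∧B + (count T? n + 1)           <⟨ +-monoʳ-< #A∧B (+-monoʳ-< (count T? n) ≤-refl) ⟩
  #A∧B + (count T? n + 2)           ≤⟨ +-monoʳ-≤ #A∧B T+2≤U ⟩
  #A∧B + count U? n                 ≤⟨ +-monoʳ-≤ #A∧B (count-mono U? A∧¬B? n U⊆A∖B) ⟩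
  #A∧B + count A∧¬B? n              ≡⟨ sym (count-split A? B? n) ⟩
  count A? n                        ∎
  where
  open ≤-Reasoning
  B∧A? A∧B? B∧¬A? A∧¬B? : Decidable _
  B∧A?  y = B? y ×-dec A? y
  A∧B?  y = A? y ×-dec B? y
  B∧¬A? y = B? y ×-dec ¬? (A? y)
  A∧¬B? y = A? y ×-dec ¬? (B? y)
  #A∧B : ℕ
  #A∧B = count A∧B? n
  swap : ∀ {P Q : Pred ℕ 0ℓ} y → y < n → P y × Q y → Q y × P y
  swap _ _ (p , q) = q , p
  B∖A-bound : count B∧¬A? n ≤ count T? n + 1
  B∖A-bound = begin
    count B∧¬A? n                               ≤⟨ count-mono B∧¬A? _ n (λ y y<n (By , ¬Ay) → B∖A⊆T+a y y<n By ¬Ay) ⟩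
    count (λ y → T? y ⊎-dec (y ≟ a)) n          ≤⟨ count-union T? (_≟ a) n ⟩
    count T? n + count (_≟ a) n                 ≤⟨ +-monoʳ-≤ (count T? n) (count-point≤1 a n) ⟩
    count T? n + 1                              ∎

mod≡% : ∀ x n .{{_ : NonZero n}} → x mod n ≡ x % n
mod≡% x (suc n) = refl

deg-count : ∀ {n x} .{{_ : NonZero n}} → x < n → deg n x ≡ count (adj? n x) n
deg-count {n} {x} x<n = trans (cong (λ v → length (filter (adj? n v) (upTo n))) x-reduced) (count-filter (adj? n x) n)
  where
  x-reduced : x mod n ≡ x
  x-reduced = trans (mod≡% x n) (m<n⇒m%n≡m x<n)

module _ (n : ℕ) .{{_ : NonZero n}} where

  isPower-intro : ∀ k x y → (k * x) % n ≡ y → IsPower n x y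
  isPower-intro k x y kx≡y = Any.map (λ { refl → reduced }) (∈-upTo⁺ (m%n<n k n))
    where
    open ≡-Reasoning
    reduced : ((k % n) * x) mod n ≡ y
    reduced = begin
      ((k % n) * x) mod n          ≡⟨ mod≡% _ n ⟩
      ((k % n) * x) % n            ≡⟨ %-distribˡ-* (k % n) x n ⟩
      ((k % n % n) * (x % n)) % n  ≡⟨ cong (λ u → (u * (x % n)) % n) (m%n%n≡m%n k n) ⟩
      ((k % n) * (x % n)) % n      ≡⟨ sym (%-distribˡ-* k x n) ⟩
      (k * x) % n                  ≡⟨ kx≡y ⟩
      y                            ∎

  isPower-elim : ∀ x y → IsPower n x y → ∃ λ k → (k * x) % n ≡ y
  isPower-elim x y p with satisfied p
  ... | k , kx≡y = k , trans (sym (mod≡% (k * x) n)) kx≡y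

  isPower-multiple : ∀ w x y → y ≡ w * x → y < n → IsPower n x y
  isPower-multiple w x y y≡wx y<n =
    isPower-intro w x y (trans (cong (_% n) (sym y≡wx)) (m<n⇒m%n≡m y<n))

  isPower-trans : ∀ x y z → IsPower n x y → IsPower n y z → IsPower n x z
  isPower-trans x y z x→y y→z with isPower-elim x y x→y | isPower-elim y z y→z
  ... | k , refl | l , refl = isPower-intro (l * k) x _ (begin
    (l * k * x) % n                  ≡⟨ cong (_% n) (*-assoc l k x) ⟩
    (l * (k * x)) % n                ≡⟨ %-distribˡ-* l (k * x) n ⟩
    (l % n * ((k * x) % n)) % n      ≡⟨ cong (λ u → (l % n * u) % n) (sym (m%n%n≡m%n (k * x) n)) ⟩
    (l % n * ((k * x) % n % n)) % n  ≡⟨ sym (%-distribˡ-* l ((k * x) % n) n) ⟩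
    (l * ((k * x) % n)) % n          ∎)
    where open ≡-Reasoning

  isPower-divisor : ∀ d x y → d ∣ n → d ∣ x → IsPower n x y → d ∣ y
  isPower-divisor d x y d∣n d∣x x→y with isPower-elim x y x→y
  ... | k , refl = %-presˡ-∣ (∣-trans d∣x (n∣m*n k)) d∣n

modular-inverse : ∀ w N .{{_ : NonZero N}} → Coprime w N → ∃ λ k → (k * w) % N ≡ 1 % N
modular-inverse w N w⊥N with coprime-Bézout w⊥N
... | Bézout.+- x y 1+yN≡xw = x , (begin
  (x * w) % N      ≡⟨ cong (_% N) (sym 1+yN≡xw) ⟩
  (1 + y * N) % N  ≡⟨ [m+kn]%n≡m%n 1 y N ⟩
  1 % N            ∎)
  where open ≡-Reasoning
... | Bézout.-+ x y 1+xw≡yN = x * x * w , (begin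
  (x * x * w * w) % N              ≡⟨ sym ([m+kn]%n≡m%n (x * x * w * w) (2 * y) N) ⟩
  (x * x * w * w + 2 * y * N) % N  ≡⟨ cong (_% N) square ⟩
  (1 + y * y * N * N) % N          ≡⟨ [m+kn]%n≡m%n 1 (y * y * N) N ⟩
  1 % N                            ∎)
  where
  open ≡-Reasoning
  -- squaring 1 + x·w = y·N shows that x²w is an inverse of w
  square : x * x * w * w + 2 * y * N ≡ 1 + y * y * N * N
  square = begin
    x * x * w * w + 2 * y * N        ≡⟨ cong (x * x * w * w +_) (*-assoc 2 y N) ⟩
    x * x * w * w + 2 * (y * N)      ≡⟨ cong (λ u → x * x * w * w + 2 * u) (sym 1+xw≡yN) ⟩
    x * x * w * w + 2 * (1 + x * w)  ≡⟨ expand x w ⟩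
    1 + (1 + x * w) * (1 + x * w)    ≡⟨ cong (λ u → 1 + u * u) 1+xw≡yN ⟩
    1 + (y * N) * (y * N)            ≡⟨ cong (1 +_) (regroup y N) ⟩
    1 + y * y * N * N                ∎
    where
    expand : ∀ x w → x * x * w * w + 2 * (1 + x * w) ≡ 1 + (1 + x * w) * (1 + x * w)
    expand = solve-∀
    regroup : ∀ y N → (y * N) * (y * N) ≡ y * y * N * N
    regroup = solve-∀

-- If n = N·d and w is coprime to N, then every multiple c·d below n is a power of
-- w·d: with k an inverse of w modulo N, (k·c)·(w·d) ≡ c·d (mod N·d).
isPower-coprime-multiple : ∀ n N d w c .{{_ : NonZero n}} .{{_ : NonZero N}} →
                           n ≡ N * d → Coprime w N → c * d < n → IsPower n (w * d) (c * d)
isPower-coprime-multiple .(N * d) N d w c refl w⊥N cd<n with modular-inverse w N w⊥N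
... | k , kw≡1 = isPower-intro (N * d) (k * c) (w * d) (c * d) (begin
  (k * c * (w * d)) % (N * d) ≡⟨ cong (_% (N * d)) (regroup k c w d) ⟩
  (k * w * c * d) % (N * d)   ≡⟨ sym (m%n*o≡m*o%[n*o] (k * w * c) N d) ⟩
  (k * w * c) % N * d         ≡⟨ cong (_* d) kwc≡c ⟩
  c % N * d                   ≡⟨ m%n*o≡m*o%[n*o] c N d ⟩
  (c * d) % (N * d)           ≡⟨ m<n⇒m%n≡m cd<n ⟩
  c * d                       ∎)
  where
  open ≡-Reasoning
  regroup : ∀ k c w d → k * c * (w * d) ≡ k * w * c * d
  regroup = solve-∀
  kwc≡c : (k * w * c) % N ≡ c % N
  kwc≡c = begin
    (k * w * c) % N               ≡⟨ %-distribˡ-* (k * w) c N ⟩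
    ((k * w) % N * (c % N)) % N   ≡⟨ cong (λ u → (u * (c % N)) % N) kw≡1 ⟩
    (1 % N * (c % N)) % N         ≡⟨ sym (%-distribˡ-* 1 c N) ⟩
    (1 * c) % N                   ≡⟨ cong (_% N) (*-identityˡ c) ⟩
    c % N                         ∎

prime≥2 : ∀ {p} → Prime p → 2 ≤ p
prime≥2 p-prime = nonTrivial⇒n>1 _ {{prime⇒nonTrivial p-prime}}

prime-coprime : ∀ {p w} → Prime p → ¬ p ∣ w → Coprime w p
prime-coprime p-prime p∤w (e∣w , e∣p) with prime⇒irreducible p-prime e∣p
... | inj₁ e≡1 = e≡1
... | inj₂ refl = ⊥-elim (p∤w e∣w)

prime∣prime : ∀ {p p′} → Prime p → Prime p′ → p ∣ p′ → p ≡ p′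
prime∣prime p-prime p′-prime p∣p′ with prime⇒irreducible p′-prime p∣p′
... | inj₂ p≡p′ = p≡p′
... | inj₁ refl with () ← p-prime

distinct-primes-coprime : ∀ {p p′} → Prime p → Prime p′ → p ≢ p′ → Coprime p′ p
distinct-primes-coprime p-prime p′-prime p≢p′ =
  prime-coprime p-prime (p≢p′ ∘ prime∣prime p-prime p′-prime)

coprime-* : ∀ {w a b} → Coprime w a → Coprime w b → Coprime w (a * b)
coprime-* {a = a} w⊥a w⊥b {e} (e∣w , e∣ab) = w⊥b (e∣w , coprime-divisor e⊥a e∣ab)
  where
  e⊥a : Coprime e a
  e⊥a (f∣e , f∣a) = w⊥a (∣-trans f∣e e∣w , f∣a)

coprime-^ : ∀ {w p} k → (0 < k → Coprime w p) → Coprime w (p ^ k)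
coprime-^ zero    _   (_ , e∣1) = ∣1⇒≡1 e∣1
coprime-^ (suc k) w⊥p = coprime-* (w⊥p z<s) (coprime-^ k (λ _ → w⊥p z<s))

prime∣^ : ∀ {p x} k → Prime p → p ∣ x ^ k → p ∣ x
prime∣^ zero    p-prime p∣1 with refl ← ∣1⇒≡1 p∣1 with () ← p-prime
prime∣^ {x = x} (suc k) p-prime p∣x^k+1 with euclidsLemma x (x ^ k) p-prime p∣x^k+1
... | inj₁ p∣x   = p∣x
... | inj₂ p∣x^k = prime∣^ k p-prime p∣x^k

prime∣prime^ : ∀ {p p′} k → Prime p → Prime p′ → p ∣ p′ ^ k → p ≡ p′
prime∣prime^ k p-prime p′-prime = prime∣prime p-prime p′-prime ∘ prime∣^ k p-prime

*-∣-* : ∀ d {p w} → p ∣ w → d * p ∣ w * d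
*-∣-* d {p} {w} p∣w = subst (d * p ∣_) (*-comm d w) (*-monoʳ-∣ d p∣w)

Primitive : ℕ → List ℕ → ℕ → Set
Primitive d ps y = d ∣ y × All (λ p → ¬ (d * p ∣ y)) ps

primitive? : ∀ d ps → Decidable (Primitive d ps)
primitive? d ps y = d ∣? y ×-dec all? (λ p → ¬? (d * p ∣? y)) ps

∣-combine : ∀ d p p′ y .{{_ : NonZero d}} → Coprime p′ p → d * p ∣ y → d * p′ ∣ y → d * p * p′ ∣ y
∣-combine d p p′ _ p′⊥p (divides u refl) dp′∣y with coprime-divisor p′⊥p (*-cancelˡ-∣ d dp′∣dpu)
  where
  dp′∣dpu : d * p′ ∣ d * (p * u)
  dp′∣dpu = subst (d * p′ ∣_) (regroup u d p) dp′∣y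
    where
    regroup : ∀ u d p → u * (d * p) ≡ d * (p * u)
    regroup = solve-∀
... | divides v refl = divides v (regroup v p′ d p)
  where
  regroup : ∀ v p′ d p → v * p′ * (d * p) ≡ v * (d * p * p′)
  regroup = solve-∀

primitive-multiple : ∀ d p ps {y} → Primitive d ps y → d * p ∣ y → Primitive (d * p) ps y
primitive-multiple d p ps (_ , dps∤y) dp∣y = dp∣y , All.map (λ dq∤y → dq∤y ∘ ∣-trans (divides p (regroup d p _))) dps∤y
  where
  regroup : ∀ d p q → d * p * q ≡ p * (d * q)
  regroup = solve-∀

primitive-divisor : ∀ d p ps {y} .{{_ : NonZero d}} → Prime p → All Prime ps → All (p ≢_) ps →
                    Primitive (d * p) ps y → Primitive d ps y
primitive-divisor d p [] _ [] [] (dp∣y , []) = ∣-trans (divides p (*-comm d p)) dp∣y , []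
primitive-divisor d p (q ∷ qs) p-prime (q-prime ∷ qs-prime) (p≢q ∷ p≢qs) (dp∣y , dpq∤y ∷ dpqs∤y)
  with d∣y , dqs∤y ← primitive-divisor d p qs p-prime qs-prime p≢qs (dp∣y , dpqs∤y) =
  d∣y , (dpq∤y ∘ ∣-combine d p q _ (distinct-primes-coprime p-prime q-prime p≢q) dp∣y) ∷ dqs∤y

-- Induction on ps: the primitive multiples for d and p ∷ ps are those for d and ps
-- minus those that are also multiples of d·p, i.e. the primitive ones for d·p and ps.
count-primitive : ∀ d ps t .{{_ : NonZero d}} → All Prime ps → AllPairs _≢_ ps →
                  count (primitive? d ps) (d * (product ps * t)) ≡ t * product (map pred ps)
count-primitive d [] t [] [] = begin
  count (primitive? d []) (d * (1 * t)) ≡⟨ cong (count (primitive? d [])) (trans (cong (d *_) (*-identityˡ t)) (*-comm d t)) ⟩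
  count (primitive? d []) (t * d)       ≡⟨ count-cong _ (d ∣?_) (t * d) (λ _ _ → proj₁) (λ _ _ d∣y → d∣y , []) ⟩
  count (d ∣?_) (t * d)                 ≡⟨ count-multiples d t ⟩
  t                                     ≡⟨ sym (*-identityʳ t) ⟩
  t * 1                                 ∎
  where open ≡-Reasoning
count-primitive d (p ∷ ps) t (p-prime ∷ ps-prime) (p≢ps ∷ ps-distinct) =
  +-cancelʳ-≡ (t * Φ) _ _ (begin
    count (primitive? d (p ∷ ps)) n₀ + t * Φ     ≡⟨ cong₂ _+_ (sym not-dp) (sym dp) ⟩
    #not-dp + #dp                                ≡⟨ +-comm #not-dp #dp ⟩
    #dp + #not-dp                                ≡⟨ sym (count-split (primitive? d ps) (d * p ∣?_) n₀) ⟩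
    count (primitive? d ps) n₀                   ≡⟨ cong (count _) (cong (d *_) (regroup₁ p M t)) ⟩
    count (primitive? d ps) (d * (M * (p * t)))  ≡⟨ count-primitive d ps (p * t) ps-prime ps-distinct ⟩
    p * t * Φ                                    ≡⟨ cong (λ x → x * t * Φ) (sym (suc-pred p)) ⟩
    suc (pred p) * t * Φ                         ≡⟨ regroup₂ (pred p) t Φ ⟩
    t * (pred p * Φ) + t * Φ                     ∎)
  where
  open ≡-Reasoning
  instance
    p≢0 : NonZero p
    p≢0 = prime⇒nonZero p-prime
    dp≢0 : NonZero (d * p)
    dp≢0 = m*n≢0 d p
  M Φ n₀ #dp #not-dp : ℕ
  M  = product ps
  Φ  = product (map pred ps)
  n₀ = d * (p * M * t)
  #dp     = count (λ y → primitive? d ps y ×-dec (d * p ∣? y)) n₀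
  #not-dp = count (λ y → primitive? d ps y ×-dec ¬? (d * p ∣? y)) n₀
  regroup₁ : ∀ p M t → p * M * t ≡ M * (p * t)
  regroup₁ = solve-∀
  regroup₂ : ∀ p′ t Φ → suc p′ * t * Φ ≡ t * (p′ * Φ) + t * Φ
  regroup₂ = solve-∀
  regroup₃ : ∀ d p M t → d * (p * M * t) ≡ d * p * (M * t)
  regroup₃ = solve-∀
  dp : #dp ≡ t * Φ
  dp = begin
    #dp                                          ≡⟨ count-cong _ _ n₀ (λ _ _ (prim , dp∣y) → primitive-multiple d p ps prim dp∣y)
                                                      (λ _ _ prim → primitive-divisor d p ps p-prime ps-prime p≢ps prim , proj₁ prim) ⟩
    count (primitive? (d * p) ps) n₀             ≡⟨ cong (count _) (regroup₃ d p M t) ⟩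
    count (primitive? (d * p) ps) (d * p * (M * t)) ≡⟨ count-primitive (d * p) ps t ps-prime ps-distinct ⟩
    t * Φ                                        ∎
  not-dp : #not-dp ≡ count (primitive? d (p ∷ ps)) n₀
  not-dp = count-cong _ _ n₀
    (λ _ _ ((d∣y , dqs∤y) , dp∤y) → d∣y , dp∤y ∷ dqs∤y)
    (λ _ _ (d∣y , dps∤y) → (d∣y , All.tail dps∤y) , All.head dps∤y)

-- Writing q, r, s as offsets from their least admissible values, the difference of
-- the two sides is a polynomial with nonnegative coefficients (s = 2 forces q ≥ 3).
key-inequality : ∀ q r s → 2 ≤ q → q < r → 2 ≤ s → s ≢ q →
                 q * q * (r + s) + 2 * q * r ≤ r * r * pred q * pred r * pred s
key-inequality (suc (suc Q)) r (suc (suc s′)) (s≤s (s≤s _)) q<r (s≤s (s≤s _)) s≢q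
  with m≤n⇒∃[o]m+o≡n q<r
key-inequality (suc (suc Q)) ._ (suc (suc (suc S))) _ _ _ _ | R , refl =
  ≤-trans (m≤m+n _ _) (≤-reflexive (difference Q R S))
  where
  difference : ∀ Q R S →
    let q = 2 + Q; r = 3 + Q + R; s = 3 + S in
    q * q * (r + s) + 2 * q * r
    + (40 * Q + 34 * R + 14 * S + 46 * Q * Q + 68 * Q * R + 35 * Q * S + 16 * R * R
       + 21 * R * S + 17 * Q * Q * Q + 37 * Q * Q * R + 28 * Q * Q * S + 22 * Q * R * R
       + 37 * Q * R * S + 2 * R * R * R + 8 * R * R * S + 2 * Q * Q * Q * Q
       + 6 * Q * Q * Q * R + 9 * Q * Q * Q * S + 6 * Q * Q * R * R + 19 * Q * Q * R * S
       + 2 * Q * R * R * R + 11 * Q * R * R * S + R * R * R * S + Q * Q * Q * Q * S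
       + 3 * Q * Q * Q * R * S + 3 * Q * Q * R * R * S + Q * R * R * R * S)
    ≡ r * r * (1 + Q) * (2 + Q + R) * (2 + S)
  difference = solve-∀
key-inequality (suc (suc zero)) _ (suc (suc zero)) _ _ _ s≢q | _ = ⊥-elim (s≢q refl)
key-inequality (suc (suc (suc Q))) ._ (suc (suc zero)) _ _ _ _ | R , refl =
  ≤-trans (m≤m+n _ _) (≤-reflexive (difference Q R))
  where
  difference : ∀ Q R →
    let q = 3 + Q; r = 4 + Q + R; s = 2 in
    q * q * (r + s) + 2 * q * r
    + (18 + 69 * Q + 65 * R + 48 * Q * Q + 76 * Q * R + 22 * R * R + 12 * Q * Q * Q
       + 27 * Q * Q * R + 17 * Q * R * R + 2 * R * R * R + Q * Q * Q * Q + 3 * Q * Q * Q * R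
       + 3 * Q * Q * R * R + Q * R * R * R)
    ≡ r * r * (2 + Q) * (3 + Q + R) * 1
  difference = solve-∀

absorb-constant : ∀ A c X .{{_ : NonZero X}} → A * X + c ≤ (A + c) * X
absorb-constant A c X = begin
  A * X + c      ≤⟨ +-monoʳ-≤ (A * X) (m≤m*n c X) ⟩
  A * X + c * X  ≡⟨ sym (*-distribʳ-+ X A c) ⟩
  (A + c) * X    ∎
  where open ≤-Reasoning

-- The neighbourhood analysis for fixed primes q < r, s ∉ {q, r} and exponents
-- β = 1 + β′, γ = 2 + γ′ for a, with n = q^(β+e)·r^(γ+f)·s^(1+c).
module DegreeDrop
  (q r s : ℕ) (q-prime : Prime q) (r-prime : Prime r) (s-prime : Prime s)
  (q<r : q < r) (q≢s : q ≢ s) (r≢s : r ≢ s)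
  (β′ γ′ e f c : ℕ) where

  instance
    q≢0 : NonZero q
    q≢0 = prime⇒nonZero q-prime
    r≢0 : NonZero r
    r≢0 = prime⇒nonZero r-prime
    s≢0 : NonZero s
    s≢0 = prime⇒nonZero s-prime

  n a b d : ℕ
  n = q ^ (suc β′ + e) * r ^ (suc (suc γ′) + f) * s ^ suc c
  a = q ^ suc β′ * r ^ suc (suc γ′)
  b = q ^ β′ * r ^ suc (suc γ′)
  d = q ^ suc β′

  Q₀ E G F S : ℕ
  Q₀ = q ^ β′
  E  = q ^ e
  G  = r ^ γ′
  F  = r ^ f
  S  = s ^ c

  instance
    Q₀≢0 : NonZero Q₀
    Q₀≢0 = m^n≢0 q β′
    E≢0 : NonZero E
    E≢0 = m^n≢0 q e
    G≢0 : NonZero G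
    G≢0 = m^n≢0 r γ′
    F≢0 : NonZero F
    F≢0 = m^n≢0 r f
    S≢0 : NonZero S
    S≢0 = m^n≢0 s c
    d≢0 : NonZero d
    d≢0 = m^n≢0 q (suc β′)
    b≢0 : NonZero b
    b≢0 = m*n≢0 Q₀ (r ^ suc (suc γ′)) {{Q₀≢0}} {{m^n≢0 r (suc (suc γ′))}}
    a≢0 : NonZero a
    a≢0 = m*n≢0 d (r ^ suc (suc γ′)) {{d≢0}} {{m^n≢0 r (suc (suc γ′))}}
    n≢0 : NonZero n
    n≢0 = m*n≢0 (q ^ (suc β′ + e) * r ^ (suc (suc γ′) + f)) (s ^ suc c)
                {{m*n≢0 _ _ {{m^n≢0 q (suc β′ + e)}} {{m^n≢0 r (suc (suc γ′) + f)}}}} {{m^n≢0 s (suc c)}}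

  n-normal : n ≡ q * (Q₀ * E) * (r * (r * (G * F))) * (s * S)
  n-normal = cong₂ (λ x y → q * x * (r * (r * y)) * (s * S)) (^-distribˡ-+-* q β′ e) (^-distribˡ-+-* r γ′ f)

  N_b N_d K : ℕ
  N_b = q ^ suc e * r ^ f * s ^ suc c
  N_d = q ^ e * r ^ (suc (suc γ′) + f) * s ^ suc c
  K   = q * E * F * S

  instance
    N_b≢0 : NonZero N_b
    N_b≢0 = m*n≢0 (q ^ suc e * F) (s ^ suc c) {{m*n≢0 _ F {{m^n≢0 q (suc e)}}}} {{m^n≢0 s (suc c)}}
    N_d≢0 : NonZero N_d
    N_d≢0 = m*n≢0 (E * r ^ (suc (suc γ′) + f)) (s ^ suc c) {{m*n≢0 E _ {{E≢0}} {{m^n≢0 r (suc (suc γ′) + f)}}}}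
                  {{m^n≢0 s (suc c)}}

  n≡N_b·b : n ≡ N_b * b
  n≡N_b·b = trans n-normal (regroup q r s Q₀ E G F S)
    where
    regroup : ∀ q r s Q₀ E G F S → q * (Q₀ * E) * (r * (r * (G * F))) * (s * S) ≡
                                   q * E * F * (s * S) * (Q₀ * (r * (r * G)))
    regroup = solve-∀

  n≡N_d·d : n ≡ N_d * d
  n≡N_d·d = trans n-normal (trans (regroup q r s Q₀ E G F S)
              (cong (λ x → E * (r * (r * x)) * (s * S) * d) (sym (^-distribˡ-+-* r γ′ f))))
    where
    regroup : ∀ q r s Q₀ E G F S → q * (Q₀ * E) * (r * (r * (G * F))) * (s * S) ≡
                                   E * (r * (r * (G * F))) * (s * S) * (q * Q₀)
    regroup = solve-∀

  n≡bs·K : n ≡ b * s * K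
  n≡bs·K = trans n-normal (regroup q r s Q₀ E G F S)
    where
    regroup : ∀ q r s Q₀ E G F S → q * (Q₀ * E) * (r * (r * (G * F))) * (s * S) ≡
                                   Q₀ * (r * (r * G)) * s * (q * E * F * S)
    regroup = solve-∀

  a≡q·b : a ≡ q * b
  a≡q·b = *-assoc q Q₀ (r ^ suc (suc γ′))

  a<n : a < n
  a<n = subst (a <_) (sym n≡a·m) (m<m*n a (E * F * (s * S)) 1<m)
    where
    regroup : ∀ q r s Q₀ E G F S → q * (Q₀ * E) * (r * (r * (G * F))) * (s * S) ≡
                                   q * Q₀ * (r * (r * G)) * (E * F * (s * S))
    regroup = solve-∀
    n≡a·m : n ≡ a * (E * F * (s * S))
    n≡a·m = trans n-normal (regroup q r s Q₀ E G F S)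
    1<m : 1 < E * F * (s * S)
    1<m = begin-strict
      1                   <⟨ prime≥2 s-prime ⟩
      s                   ≤⟨ m≤m*n s S ⟩
      s * S               ≤⟨ m≤n*m (s * S) (E * F) {{m*n≢0 E F}} ⟩
      E * F * (s * S)     ∎
      where open ≤-Reasoning

  -- The b-neighbours that are not a-neighbours (apart from a itself) turn out to be
  -- multiples of b·s, or of b·r when b·r still divides n.
  Tail : ℕ → Set
  Tail y = (b * s ∣ y × b * s ∣ n) ⊎ (b * r ∣ y × b * r ∣ n)

  tail? : (y : ℕ) → Dec (Tail y)
  tail? y = (b * s ∣? y ×-dec b * s ∣? n) ⊎-dec (b * r ∣? y ×-dec b * r ∣? n)

  tail-bound : r * count tail? n ≤ (r + s) * K
  tail-bound = begin
    r * count tail? n      ≤⟨ *-monoʳ-≤ r (count-union _ _ n) ⟩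
    r * (#bs + #br)        ≡⟨ *-distribˡ-+ r #bs #br ⟩
    r * #bs + r * #br      ≤⟨ +-mono-≤ (*-monoʳ-≤ r #bs≤K) r·#br≤s·K ⟩
    r * K + s * K          ≡⟨ sym (*-distribʳ-+ K r s) ⟩
    (r + s) * K            ∎
    where
    open ≤-Reasoning
    instance
      bs≢0 : NonZero (b * s)
      bs≢0 = m*n≢0 b s
      br≢0 : NonZero (b * r)
      br≢0 = m*n≢0 b r
    #bs #br : ℕ
    #bs = count (λ y → b * s ∣? y ×-dec b * s ∣? n) n
    #br = count (λ y → b * r ∣? y ×-dec b * r ∣? n) n
    #bs≤K : #bs ≤ K
    #bs≤K = *-cancelˡ-≤ (b * s) (subst (b * s * #bs ≤_) n≡bs·K (count-multiples-bound (b * s) n))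
    r·#br≤s·K : r * #br ≤ s * K
    r·#br≤s·K = *-cancelˡ-≤ b (begin
      b * (r * #br)  ≡⟨ sym (*-assoc b r #br) ⟩
      b * r * #br    ≤⟨ count-multiples-bound (b * r) n ⟩
      n              ≡⟨ n≡bs·K ⟩
      b * s * K      ≡⟨ *-assoc b s K ⟩
      b * (s * K)    ∎)

  -- The primes dividing N_d = n/d (q only when e > 0) and the cofactor t with
  -- N_d = (∏ primes)·t; the primitive multiples of d are then counted by count-primitive.
  primes : ℕ → List ℕ
  primes zero    = r ∷ s ∷ []
  primes (suc _) = q ∷ r ∷ s ∷ []

  cofactor : ℕ → ℕ
  cofactor zero    = r * G * F * S
  cofactor (suc k) = q ^ k * r * G * F * S

  primes-prime : ∀ k → All Prime (primes k)
  primes-prime zero    = r-prime ∷ s-prime ∷ []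
  primes-prime (suc _) = q-prime ∷ r-prime ∷ s-prime ∷ []

  primes-distinct : ∀ k → AllPairs _≢_ (primes k)
  primes-distinct zero    = (r≢s ∷ []) ∷ [] ∷ []
  primes-distinct (suc _) = (<⇒≢ q<r ∷ q≢s ∷ []) ∷ (r≢s ∷ []) ∷ [] ∷ []

  primes-cofactor : ∀ k → q ^ k * (r * (r * (G * F))) * (s * S) ≡ product (primes k) * cofactor k
  primes-cofactor zero    = regroup r s G F S
    where
    regroup : ∀ r s G F S → 1 * (r * (r * (G * F))) * (s * S) ≡ r * (s * 1) * (r * G * F * S)
    regroup = solve-∀
  primes-cofactor (suc k) = regroup q r s (q ^ k) G F S
    where
    regroup : ∀ q r s Qk G F S → q * Qk * (r * (r * (G * F))) * (s * S) ≡
                                 q * (r * (s * 1)) * (Qk * r * G * F * S)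
    regroup = solve-∀

  n≡d·∏primes·t : n ≡ d * (product (primes e) * cofactor e)
  n≡d·∏primes·t = trans n-normal (trans (regroup q Q₀ E (r * (r * (G * F))) (s * S))
                                        (cong (d *_) (primes-cofactor e)))
    where
    regroup : ∀ q Q₀ E R S → q * (Q₀ * E) * R * S ≡ q * Q₀ * (E * R * S)
    regroup = solve-∀

  -- q·r·#primitive ≥ r²(q − 1)(r − 1)(s − 1)·(EFSG): an equality for k > 0,
  -- and for k = 0 only the factor q − 1 ≤ q is lost.
  primitive-lower-bound : ∀ k →
    r * r * pred q * pred r * pred s * (q ^ k * F * S * G) ≤ q * r * (cofactor k * product (map pred (primes k)))
  primitive-lower-bound zero = begin
    r * r * pred q * pred r * pred s * (1 * F * S * G)  ≤⟨ *-monoˡ-≤ _ (*-monoˡ-≤ _ (*-monoˡ-≤ _ (*-monoʳ-≤ (r * r) pred[n]≤n))) ⟩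
    r * r * q * pred r * pred s * (1 * F * S * G)       ≡⟨ regroup q r (pred r) (pred s) G F S ⟩
    q * r * (r * G * F * S * (pred r * (pred s * 1)))   ∎
    where
    open ≤-Reasoning
    regroup : ∀ q r r′ s′ G F S → r * r * q * r′ * s′ * (1 * F * S * G) ≡ q * r * (r * G * F * S * (r′ * (s′ * 1)))
    regroup = solve-∀
  primitive-lower-bound (suc k) = ≤-reflexive (regroup q r (q ^ k) (pred q) (pred r) (pred s) G F S)
    where
    regroup : ∀ q r Qk q′ r′ s′ G F S → r * r * q′ * r′ * s′ * (q * Qk * F * S * G) ≡
                                        q * r * (Qk * r * G * F * S * (q′ * (r′ * (s′ * 1))))
    regroup = solve-∀

  primitive-avoids-r-s : ∀ k {y} → Primitive d (primes k) y → ¬ d * r ∣ y × ¬ d * s ∣ y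
  primitive-avoids-r-s zero    (_ , dr∤y ∷ ds∤y ∷ [])     = dr∤y , ds∤y
  primitive-avoids-r-s (suc _) (_ , _ ∷ dr∤y ∷ ds∤y ∷ []) = dr∤y , ds∤y

  primitive-coprime-q : ∀ k {w} → Primitive d (primes k) (w * d) → Coprime w (q ^ k)
  primitive-coprime-q zero    _              = coprime-^ {p = q} 0 (λ ())
  primitive-coprime-q (suc k) (_ , dq∤y ∷ _) = coprime-^ (suc k) (λ _ → prime-coprime q-prime (dq∤y ∘ *-∣-* d))

  #primitive : count (primitive? d (primes e)) n ≡ cofactor e * product (map pred (primes e))
  #primitive = trans (cong (count _) n≡d·∏primes·t)
                     (count-primitive d (primes e) (cofactor e) (primes-prime e) (primes-distinct e))

  tail+2≤primitive : count tail? n + 2 ≤ count (primitive? d (primes e)) n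
  tail+2≤primitive = *-cancelˡ-≤ (q * r) {{m*n≢0 q r}} (begin
    q * r * (#tail + 2)                           ≡⟨ regroup₁ q r #tail ⟩
    q * (r * #tail) + 2 * q * r                   ≤⟨ +-monoˡ-≤ (2 * q * r) (*-monoʳ-≤ q tail-bound) ⟩
    q * ((r + s) * K) + 2 * q * r                 ≡⟨ cong (_+ 2 * q * r) (regroup₂ q r s E F S) ⟩
    q * q * (r + s) * X + 2 * q * r               ≤⟨ absorb-constant (q * q * (r + s)) (2 * q * r) X {{X≢0}} ⟩
    (q * q * (r + s) + 2 * q * r) * X             ≤⟨ *-monoˡ-≤ X key ⟩
    r * r * pred q * pred r * pred s * X          ≤⟨ *-monoʳ-≤ (r * r * pred q * pred r * pred s) (m≤m*n X G) ⟩
    r * r * pred q * pred r * pred s * (X * G)    ≤⟨ primitive-lower-bound e ⟩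
    q * r * (cofactor e * product (map pred (primes e))) ≡⟨ cong (q * r *_) (sym #primitive) ⟩
    q * r * count (primitive? d (primes e)) n     ∎)
    where
    open ≤-Reasoning
    #tail X : ℕ
    #tail = count tail? n
    X = E * F * S
    X≢0 : NonZero X
    X≢0 = m*n≢0 (E * F) S {{m*n≢0 E F}}
    key : q * q * (r + s) + 2 * q * r ≤ r * r * pred q * pred r * pred s
    key = key-inequality q r s (prime≥2 q-prime) q<r (prime≥2 s-prime) (q≢s ∘ sym)
    regroup₁ : ∀ q r t → q * r * (t + 2) ≡ q * (r * t) + 2 * q * r
    regroup₁ = solve-∀
    regroup₂ : ∀ q r s E F S → q * ((r + s) * (q * E * F * S)) ≡ q * q * (r + s) * (E * F * S)
    regroup₂ = solve-∀

  b∣n : b ∣ n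
  b∣n = divides N_b n≡N_b·b

  d∣n : d ∣ n
  d∣n = divides N_d n≡N_d·d

  -- If b is a power of y, so is a = q·b.  Otherwise y = w·b is a multiple of b; if q ∣ w
  -- then y is a multiple of a, and if w is coprime to n/b then a is a power of y.
  b-only-neighbour : ∀ y → y < n → Adj n b y → ¬ Adj n a y → Tail y ⊎ y ≡ a
  b-only-neighbour y y<n (_ , b~y) ¬a~y with y ≟ a
  ... | yes y≡a = inj₂ y≡a
  ... | no  y≢a = linked b~y
    where
    ¬link : ¬ (IsPower n a y ⊎ IsPower n y a)
    ¬link link = ¬a~y (y≢a ∘ sym , link)
    linked : IsPower n b y ⊎ IsPower n y b → Tail y ⊎ y ≡ a
    linked (inj₂ y→b) = ⊥-elim (¬link (inj₂ (isPower-trans n y b a y→b (isPower-multiple n q b a a≡q·b a<n))))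
    linked (inj₁ b→y) with isPower-divisor n b b y b∣n ∣-refl b→y
    ... | divides w y≡w·b with tail? y | q ∣? w
    ...   | yes tail | _ = inj₁ tail
    ...   | no ¬tail | yes (divides w′ w≡w′·q) = ⊥-elim (¬link (inj₁ (isPower-multiple n w′ a y y≡w′·a y<n)))
      where
      y≡w′·a : y ≡ w′ * a
      y≡w′·a = trans y≡w·b (trans (cong (_* b) w≡w′·q) (trans (*-assoc w′ q b) (cong (w′ *_) (sym a≡q·b))))
    ...   | no ¬tail | no  q∤w = ⊥-elim (¬link (inj₂ (subst₂ (IsPower n) (sym y≡w·b) (sym a≡q·b) y→a)))
      where
      s∤w : ¬ s ∣ w
      s∤w s∣w = ¬tail (inj₁ (subst (b * s ∣_) (sym y≡w·b) (*-∣-* b s∣w) , divides K (trans n≡bs·K (*-comm (b * s) K))))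
      r∤w : 0 < f → ¬ r ∣ w
      r∤w 0<f r∣w = ¬tail (inj₂ (subst (b * r ∣_) (sym y≡w·b) (*-∣-* b r∣w) , br∣n))
        where
        r∣F : r ∣ F
        r∣F with f′ , refl ← m≤n⇒∃[o]m+o≡n 0<f = m∣m*n (r ^ f′)
        br∣n : b * r ∣ n
        br∣n = subst₂ _∣_ (*-comm r b) (sym n≡N_b·b)
                      (*-monoˡ-∣ b (∣-trans r∣F (n∣m*n*o (q ^ suc e) (s ^ suc c))))
      w⊥N_b : Coprime w N_b
      w⊥N_b = coprime-* (coprime-* (coprime-^ (suc e) (λ _ → prime-coprime q-prime q∤w))
                                    (coprime-^ f (prime-coprime r-prime ∘ r∤w)))
                        (coprime-^ (suc c) (λ _ → prime-coprime s-prime s∤w))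
      y→a : IsPower n (w * b) (q * b)
      y→a = isPower-coprime-multiple n N_b b w q n≡N_b·b w⊥N_b (subst (_< n) a≡q·b a<n)

  -- Primitive multiples y = w·d of d (w coprime to n/d) are neighbours of a but not of b:
  -- a is a power of y, while b is neither a power of y (that needs d ∣ b) nor has y as a
  -- power (that needs r ∣ w, i.e. d·r ∣ y).
  primitive-a-only : ∀ y → y < n → Primitive d (primes e) y → Adj n a y × ¬ Adj n b y
  primitive-a-only _ y<n prim@(divides w refl , _) = (a≢y , inj₂ y→a) , ¬b~y
    where
    dr∤y : ¬ d * r ∣ w * d
    dr∤y = proj₁ (primitive-avoids-r-s e prim)
    r∤w : ¬ r ∣ w
    r∤w = dr∤y ∘ *-∣-* d
    s∤w : ¬ s ∣ w
    s∤w = proj₂ (primitive-avoids-r-s e prim) ∘ *-∣-* d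
    w⊥N_d : Coprime w N_d
    w⊥N_d = coprime-* (coprime-* (primitive-coprime-q e prim)
                                  (coprime-^ (suc (suc γ′) + f) (λ _ → prime-coprime r-prime r∤w)))
                      (coprime-^ (suc c) (λ _ → prime-coprime s-prime s∤w))
    r∣b : r ∣ b
    r∣b = ∣-trans (m∣m*n (r * G)) (n∣m*n Q₀)
    a≡Rγ·d : a ≡ r ^ suc (suc γ′) * d
    a≡Rγ·d = *-comm d (r ^ suc (suc γ′))
    y→a : IsPower n (w * d) a
    y→a = subst (IsPower n (w * d)) (sym a≡Rγ·d)
            (isPower-coprime-multiple n N_d d w (r ^ suc (suc γ′)) n≡N_d·d w⊥N_d (subst (_< n) a≡Rγ·d a<n))
    a≢y : a ≢ w * d
    a≢y a≡y = dr∤y (subst (d * r ∣_) (trans (*-assoc d r (r * G)) a≡y) (m∣m*n (r * G)))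
    ¬b~y : ¬ Adj n b (w * d)
    -- b → y gives r ∣ b ∣ w·d, so r ∣ w or r ∣ d = q^(1+β′)
    ¬b~y (_ , inj₁ b→y) with euclidsLemma w d r-prime (∣-trans r∣b (isPower-divisor n b b _ b∣n ∣-refl b→y))
    ... | inj₁ r∣w = r∤w r∣w
    ... | inj₂ r∣d = <-irrefl (sym (prime∣prime^ (suc β′) r-prime q-prime r∣d)) q<r
    -- y → b gives d ∣ b, i.e. q·q^β′ ∣ q^β′·r^γ, so q ∣ r^γ
    ¬b~y (_ , inj₂ y→b) = <-irrefl (prime∣prime^ (suc (suc γ′)) q-prime r-prime q∣Rγ) q<r
      where
      d∣b : d ∣ b
      d∣b = isPower-divisor n d (w * d) b d∣n (n∣m*n w) y→b
      q∣Rγ : q ∣ r ^ suc (suc γ′)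
      q∣Rγ = *-cancelˡ-∣ Q₀ (subst (_∣ b) (*-comm q Q₀) d∣b)

  degree-drop : deg n a > deg n b
  degree-drop = subst₂ _<_ (sym (deg-count b<n)) (sym (deg-count a<n))
    (count-compare (adj? n a) (adj? n b) tail? (primitive? d (primes e)) a n
                   b-only-neighbour primitive-a-only tail+2≤primitive)
    where
    b<n : b < n
    b<n = ≤-<-trans (subst (b ≤_) (sym a≡q·b) (m≤n*m b q)) a<n

degree-drop-pair : ∀ {q r s} → Prime q → Prime r → Prime s → q < r → q ≢ s → r ≢ s →
                   ∀ {A B C} n → n ≡ q ^ A * r ^ B * s ^ C → 1 ≤ C →
                   ∀ β γ → 1 ≤ β → β ≤ A → 2 ≤ γ → γ ≤ B →
                   deg n (q ^ β * r ^ γ) > deg n (q ^ (β ∸ 1) * r ^ γ)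
degree-drop-pair {q} {r} {s} q-prime r-prime s-prime q<r q≢s r≢s {A} {B} {suc c} _ refl (s≤s _)
                 (suc β′) (suc (suc γ′)) (s≤s _) β≤A (s≤s (s≤s _)) γ≤B =
  subst (λ m → deg m (q ^ suc β′ * r ^ suc (suc γ′)) > deg m (q ^ β′ * r ^ suc (suc γ′)))
        (cong₂ (λ A B → q ^ A * r ^ B * s ^ suc c) (m+[n∸m]≡n β≤A) (m+[n∸m]≡n γ≤B))
        (DegreeDrop.degree-drop q r s q-prime r-prime s-prime q<r q≢s r≢s β′ γ′ (A ∸ suc β′) (B ∸ suc (suc γ′)) c)

*-swap-last : ∀ x y z → x * y * z ≡ x * z * y
*-swap-last = solve-∀

*-rotate : ∀ x y z → x * y * z ≡ y * z * x
*-rotate = solve-∀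

lemma5p1 : (p α : Fin 3 → ℕ) → (n : ℕ)
    → (∀ k → Prime (p k)) → (∀ k → 1 ≤ α k)
    → p zero < p (suc zero) → p (suc zero) < p (suc (suc zero))
    → n ≡ p zero ^ α zero * p (suc zero) ^ α (suc zero) * p (suc (suc zero)) ^ α (suc (suc zero))
    → (i j : Fin 3) → i <ᶠ j
    → (βi βj : ℕ) → 1 ≤ βi → βi ≤ α i → 2 ≤ βj → βj ≤ α j
    → deg n (p i ^ βi * p j ^ βj) > deg n (p i ^ (βi ∸ 1) * p j ^ βj)
lemma5p1 p α n p-prime α≥1 p₀<p₁ p₁<p₂ n≡ zero (suc zero) _ =
  degree-drop-pair (p-prime _) (p-prime _) (p-prime _) p₀<p₁ (<⇒≢ (<-trans p₀<p₁ p₁<p₂)) (<⇒≢ p₁<p₂)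
                   n n≡ (α≥1 _)
lemma5p1 p α n p-prime α≥1 p₀<p₁ p₁<p₂ n≡ zero (suc (suc zero)) _ =
  degree-drop-pair (p-prime _) (p-prime _) (p-prime _) (<-trans p₀<p₁ p₁<p₂) (<⇒≢ p₀<p₁) (≢-sym (<⇒≢ p₁<p₂))
                   n (trans n≡ (*-swap-last (p zero ^ α zero) _ _)) (α≥1 _)
lemma5p1 p α n p-prime α≥1 p₀<p₁ p₁<p₂ n≡ (suc zero) (suc (suc zero)) _ =
  degree-drop-pair (p-prime _) (p-prime _) (p-prime _) p₁<p₂ (≢-sym (<⇒≢ p₀<p₁)) (≢-sym (<⇒≢ (<-trans p₀<p₁ p₁<p₂)))
                   n (trans n≡ (*-rotate (p zero ^ α zero) _ _)) (α≥1 _)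
lemma5p1 _ _ _ _ _ _ _ _ zero             zero             ()
lemma5p1 _ _ _ _ _ _ _ _ (suc zero)       zero             ()
lemma5p1 _ _ _ _ _ _ _ _ (suc zero)       (suc zero)       (s≤s ())
lemma5p1 _ _ _ _ _ _ _ _ (suc (suc zero)) zero             ()
lemma5p1 _ _ _ _ _ _ _ _ (suc (suc zero)) (suc zero)       (s≤s ())
lemma5p1 _ _ _ _ _ _ _ _ (suc (suc zero)) (suc (suc zero)) (s≤s (s≤s ()))
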